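{- Let $M$ be a $3$-connected matroid with $P\subseteq E(M)$. Suppose that $P$ contains no triangles, and $P$ has a partition $(L_1,L_2,\dots,L_t)$ into $2$-element sets, for some $t\ge3$, such that $L_i\cup L_j$ is a cocircuit for all distinct $i,j\in\{1,\dots,t\}$ except possibly $\{i,j\}=\{1,2\}$. If a triangle $T$ of $M$ meets $L_i$ for some $i\in\{1,\dots,t\}$, then $L_i\subseteq T$. -}

module Defs where

open import Data.Nat using (ℕ; _+_; _∸_; _≤_; _<_)
open import Data.Fin using (Fin)
open import Data.Fin.Subset using (Subset; _⊆_; _⊂_; _∪_; _∩_; ∁; ⊤; ∣_∣)
open import Data.Product using (_×_)
open import Relation.Binary.PropositionalEquality using (_≡_)
open import Relation.Nullary using (¬_)

record Matroid (n : ℕ) : Set where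
  field
    rank       : Subset n → ℕ
    rank-bound : ∀ X → rank X ≤ ∣ X ∣
    rank-mono  : ∀ {X Y} → X ⊆ Y → rank X ≤ rank Y
    rank-submod : ∀ X Y → rank (X ∪ Y) + rank (X ∩ Y) ≤ rank X + rank Y

IndependentR : ∀ {n} → (Subset n → ℕ) → Subset n → Set
IndependentR r X = r X ≡ ∣ X ∣

CircuitR : ∀ {n} → (Subset n → ℕ) → Subset n → Set
CircuitR r C = (r C < ∣ C ∣) × (∀ X → X ⊂ C → IndependentR r X)

module _ {n : ℕ} (M : Matroid n) where
  open Matroid M

  dualRank : Subset n → ℕ
  dualRank X = ∣ X ∣ + rank (∁ X) ∸ rank ⊤

  Circuit : Subset n → Set
  Circuit = CircuitR rank

  Cocircuit : Subset n → Set
  Cocircuit = CircuitR dualRank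

  Triangle : Subset n → Set
  Triangle T = Circuit T × (∣ T ∣ ≡ 3)

  conn : Subset n → ℕ
  conn X = rank X + rank (∁ X) ∸ rank ⊤

  Separation : ℕ → Subset n → Set
  Separation k X = (k ≤ ∣ X ∣) × (k ≤ ∣ ∁ X ∣) × (conn X < k)

  ThreeConnected : Set
  ThreeConnected = ∀ k → k < 3 → ∀ X → ¬ Separation k X

-- A circuit and a cocircuit never meet in exactly one element (orthogonality). Suppose the
-- triangle T meets L_i in the single element x. Pick j with L_i ∪ L_j a cocircuit: T must
-- meet it again, hence meets L_j in some z. Pick a third index k; L_k is exempt from the
-- cocircuit condition together with at most one of i, j, so L_a ∪ L_k is a cocircuit for
-- some a ∈ {i, j}, and orthogonality produces a third element of T in P. Then the
-- 3-element set T lies in P, which is excluded.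
module Submission where

open import Defs
open import Data.Nat using (ℕ; _≤_)
open import Data.Fin using (Fin; toℕ)
open import Data.Fin.Subset using (Subset; _∈_; _⊆_; _∪_; _∩_; ∣_∣; Nonempty)
open import Data.Product using (_×_; ∃)
open import Data.Sum using (_⊎_)
open import Relation.Binary.PropositionalEquality using (_≡_; _≢_)
open import Relation.Nullary using (¬_)

open import Data.Nat using (suc; _+_; _∸_; _<_; z≤n; s≤s)
open import Data.Nat.Properties hiding (_≟_)
open import Data.Nat.Properties using () renaming (_≟_ to _≟ℕ_)
open import Data.Fin using (zero; suc; _≟_)
open import Data.Fin.Properties using (toℕ-injective; any?)
open import Data.Fin.Subset using (_∉_; _─_; _-_; ∁; ⊤; ⁅_⁆; inside; outside)
open import Data.Fin.Subset.Properties
open import Data.List using (List; []; _∷_; length)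
open import Data.List.Relation.Unary.All as All using (All; []; _∷_)
open import Data.List.Relation.Unary.AllPairs using (AllPairs; []; _∷_)
open import Data.Vec using ([]; _∷_; there)
open import Data.Product using (_,_; proj₁; proj₂)
open import Data.Sum using (inj₁; inj₂)
open import Data.Empty using (⊥-elim)
open import Function using (_∘_)
open import Relation.Nullary using (Dec; yes; no; ¬?; contradiction)
open import Relation.Nullary.Decidable using (_×-dec_; _⊎-dec_)
open import Relation.Binary.PropositionalEquality using (refl; sym; trans; cong; subst; ≢-sym; module ≡-Reasoning)

m+n∸o<m⇒n<o : ∀ m n o → m + n ∸ o < m → n < o
m+n∸o<m⇒n<o m n o lt = ≰⇒> λ o≤n → <⇒≱ lt (begin
  m          ≡⟨ m+n∸n≡m m o ⟨
  m + o ∸ o  ≤⟨ ∸-monoˡ-≤ o (+-monoʳ-≤ m o≤n) ⟩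
  m + n ∸ o  ∎)
  where open ≤-Reasoning

m+n∸o≡m⇒o≤n : ∀ m n o → o ≤ m + n → m + n ∸ o ≡ m → o ≤ n
m+n∸o≡m⇒o≤n m n o o≤m+n eq = ≤-reflexive (+-cancelˡ-≡ m o n (begin
  m + o            ≡⟨ cong (_+ o) eq ⟨
  (m + n ∸ o) + o  ≡⟨ m∸n+n≡m o≤m+n ⟩
  m + n            ∎))
  where open ≡-Reasoning

∣p∪q∣≤∣p∣+∣q∣ : ∀ {n} (p q : Subset n) → ∣ p ∪ q ∣ ≤ ∣ p ∣ + ∣ q ∣
∣p∪q∣≤∣p∣+∣q∣ [] [] = ≤-refl
∣p∪q∣≤∣p∣+∣q∣ (inside ∷ p) (inside ∷ q) = s≤s (≤-trans (∣p∪q∣≤∣p∣+∣q∣ p q) (+-monoʳ-≤ ∣ p ∣ (n≤1+n _)))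
∣p∪q∣≤∣p∣+∣q∣ (inside ∷ p) (outside ∷ q) = s≤s (∣p∪q∣≤∣p∣+∣q∣ p q)
∣p∪q∣≤∣p∣+∣q∣ (outside ∷ p) (inside ∷ q) = subst (suc ∣ p ∪ q ∣ ≤_) (sym (+-suc ∣ p ∣ ∣ q ∣)) (s≤s (∣p∪q∣≤∣p∣+∣q∣ p q))
∣p∪q∣≤∣p∣+∣q∣ (outside ∷ p) (outside ∷ q) = ∣p∪q∣≤∣p∣+∣q∣ p q

x∈p─q⇒x∉q : ∀ {n x} (p q : Subset n) → x ∈ p ─ q → x ∉ q
x∈p─q⇒x∉q (_ ∷ p) (_ ∷ q) (there x∈p─q) (there x∈q) = x∈p─q⇒x∉q p q x∈p─q x∈q

module _ {n : ℕ} where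

  x∈p-y⇒x≢y : ∀ {p : Subset n} {x y} → x ∈ p - y → x ≢ y
  x∈p-y⇒x≢y {p} {y = y} x∈p-y refl = x∈p─q⇒x∉q p ⁅ y ⁆ x∈p-y (x∈⁅x⁆ y)

  ∣p∣≤1+∣p-x∣ : ∀ (p : Subset n) x → ∣ p ∣ ≤ suc ∣ p - x ∣
  ∣p∣≤1+∣p-x∣ p x = begin
    ∣ p ∣                    ≤⟨ p⊆q⇒∣p∣≤∣q∣ p⊆p-x∪x ⟩
    ∣ (p - x) ∪ ⁅ x ⁆ ∣      ≤⟨ ∣p∪q∣≤∣p∣+∣q∣ (p - x) ⁅ x ⁆ ⟩
    ∣ p - x ∣ + ∣ ⁅ x ⁆ ∣    ≡⟨ cong (∣ p - x ∣ +_) (∣⁅x⁆∣≡1 x) ⟩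
    ∣ p - x ∣ + 1            ≡⟨ +-comm ∣ p - x ∣ 1 ⟩
    suc ∣ p - x ∣            ∎
    where
    open ≤-Reasoning
    p⊆p-x∪x : p ⊆ (p - x) ∪ ⁅ x ⁆
    p⊆p-x∪x {y} y∈p with y ≟ x
    ... | yes refl = x∈p∪q⁺ (inj₂ (x∈⁅x⁆ x))
    ... | no y≢x   = x∈p∪q⁺ (inj₁ (x∈p∧x≢y⇒x∈p-y y∈p y≢x))

  Distinct : List (Fin n) → Set
  Distinct = AllPairs _≢_

  distinct⇒length≤∣p∣ : ∀ {p : Subset n} {xs} → Distinct xs → All (_∈ p) xs → length xs ≤ ∣ p ∣
  distinct⇒length≤∣p∣ [] [] = z≤n
  distinct⇒length≤∣p∣ {p} {x ∷ xs} (x≢xs ∷ distinct) (x∈p ∷ xs∈p) = begin-strict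
    length xs   ≤⟨ distinct⇒length≤∣p∣ distinct xs∈p-x ⟩
    ∣ p - x ∣   <⟨ x∈p⇒∣p-x∣<∣p∣ x∈p ⟩
    ∣ p ∣       ∎
    where
    open ≤-Reasoning
    xs∈p-x : All (_∈ p - x) xs
    xs∈p-x = All.zipWith (λ (y∈p , x≢y) → x∈p∧x≢y⇒x∈p-y y∈p (≢-sym x≢y)) (xs∈p , x≢xs)

  -- An element of p outside q, added to xs, would give one distinct element of p too many.
  distinct-filling⇒⊆ : ∀ {p q : Subset n} {xs} → Distinct xs → All (_∈ p) xs → All (_∈ q) xs
                     → ∣ p ∣ ≤ length xs → p ⊆ q
  distinct-filling⇒⊆ {q = q} {xs} distinct xs∈p xs∈q ∣p∣≤ {y} y∈p with y ∈? q
  ... | yes y∈q = y∈q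
  ... | no y∉q  = contradiction (≤-trans (distinct⇒length≤∣p∣ (y≢xs ∷ distinct) (y∈p ∷ xs∈p)) ∣p∣≤) (<-irrefl refl)
    where
    y≢xs : All (y ≢_) xs
    y≢xs = All.map (λ x∈q y≡x → y∉q (subst (_∈ q) (sym y≡x) x∈q)) xs∈q

module _ {n : ℕ} (M : Matroid n) where
  open Matroid M

  rank⊤≤∣X∣+rank∁X : ∀ X → rank ⊤ ≤ ∣ X ∣ + rank (∁ X)
  rank⊤≤∣X∣+rank∁X X = begin
    rank ⊤                                   ≡⟨ cong rank (p∪∁p≡⊤ X) ⟨
    rank (X ∪ ∁ X)                           ≤⟨ m≤m+n _ _ ⟩
    rank (X ∪ ∁ X) + rank (X ∩ ∁ X)          ≤⟨ rank-submod X (∁ X) ⟩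
    rank X + rank (∁ X)                      ≤⟨ +-monoˡ-≤ (rank (∁ X)) (rank-bound X) ⟩
    ∣ X ∣ + rank (∁ X)                       ∎
    where open ≤-Reasoning

  cocircuit⇒rank∁<rank⊤ : ∀ {D} → Cocircuit M D → rank (∁ D) < rank ⊤
  cocircuit⇒rank∁<rank⊤ {D} (dependent , _) = m+n∸o<m⇒n<o ∣ D ∣ (rank (∁ D)) (rank ⊤) dependent

  cocircuit⇒rank⊤≤rank∁[D-e] : ∀ {D e} → Cocircuit M D → e ∈ D → rank ⊤ ≤ rank (∁ (D - e))
  cocircuit⇒rank⊤≤rank∁[D-e] {D} {e} (_ , minimal) e∈D =
    m+n∸o≡m⇒o≤n ∣ D - e ∣ (rank (∁ (D - e))) (rank ⊤)
      (rank⊤≤∣X∣+rank∁X (D - e)) (minimal (D - e) (x∈p⇒p-x⊂p e∈D))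

  circuit-rank≤rank-e : ∀ {C e} → Circuit M C → e ∈ C → rank C ≤ rank (C - e)
  circuit-rank≤rank-e {C} {e} (dependent , minimal) e∈C = ≤-pred (begin-strict
    rank C          <⟨ dependent ⟩
    ∣ C ∣           ≤⟨ ∣p∣≤1+∣p-x∣ C e ⟩
    suc ∣ C - e ∣   ≡⟨ cong suc (minimal (C - e) (x∈p⇒p-x⊂p e∈C)) ⟨
    suc (rank (C - e)) ∎)
    where open ≤-Reasoning

  circuit-e⊆X⇒rank[X∪C]≤rankX : ∀ {C X e} → Circuit M C → e ∈ C → C - e ⊆ X → rank (X ∪ C) ≤ rank X
  circuit-e⊆X⇒rank[X∪C]≤rankX {C} {X} {e} circuit e∈C C-e⊆X = +-cancelʳ-≤ (rank (X ∩ C)) _ _ (begin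
    rank (X ∪ C) + rank (X ∩ C)  ≤⟨ rank-submod X C ⟩
    rank X + rank C              ≤⟨ +-monoʳ-≤ (rank X) (≤-trans (circuit-rank≤rank-e circuit e∈C) (rank-mono C-e⊆X∩C)) ⟩
    rank X + rank (X ∩ C)        ∎)
    where
    open ≤-Reasoning
    C-e⊆X∩C : C - e ⊆ X ∩ C
    C-e⊆X∩C c∈C-e = x∈p∩q⁺ (C-e⊆X c∈C-e , p─q⊆p C ⁅ e ⁆ c∈C-e)

  circuit-cocircuit-orthogonal : ∀ {C D e} → Circuit M C → Cocircuit M D → e ∈ C → e ∈ D
                               → ∃ λ u → u ∈ C × u ∈ D × u ≢ e
  circuit-cocircuit-orthogonal {C} {D} {e} circuit cocircuit e∈C e∈D
    with any? (λ u → (u ∈? C) ×-dec ((u ∈? D) ×-dec ¬? (u ≟ e)))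
  ... | yes found = found
  ... | no none = contradiction (begin-strict
    rank ⊤              ≤⟨ cocircuit⇒rank⊤≤rank∁[D-e] cocircuit e∈D ⟩
    rank (∁ (D - e))    ≤⟨ rank-mono ∁[D-e]⊆∁D∪C ⟩
    rank (∁ D ∪ C)      ≤⟨ circuit-e⊆X⇒rank[X∪C]≤rankX circuit e∈C C-e⊆∁D ⟩
    rank (∁ D)          <⟨ cocircuit⇒rank∁<rank⊤ cocircuit ⟩
    rank ⊤              ∎) (<-irrefl refl)
    where
    open ≤-Reasoning
    C-e⊆∁D : C - e ⊆ ∁ D
    C-e⊆∁D c∈C-e = x∉p⇒x∈∁p λ c∈D → none (_ , p─q⊆p C ⁅ e ⁆ c∈C-e , c∈D , x∈p-y⇒x≢y c∈C-e)
    ∁[D-e]⊆∁D∪C : ∁ (D - e) ⊆ ∁ D ∪ C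
    ∁[D-e]⊆∁D∪C {x} x∈∁[D-e] with x ≟ e
    ... | yes refl = x∈p∪q⁺ (inj₂ e∈C)
    ... | no x≢e   = x∈p∪q⁺ (inj₁ (x∉p⇒x∈∁p λ x∈D → x∈∁p⇒x∉p x∈∁[D-e] (x∈p∧x≢y⇒x∈p-y x∈D x≢e)))

Exempt : ∀ {t} → Fin t → Fin t → Set
Exempt i j = (toℕ i ≡ 0 × toℕ j ≡ 1) ⊎ (toℕ i ≡ 1 × toℕ j ≡ 0)

exempt? : ∀ {t} (i j : Fin t) → Dec (Exempt i j)
exempt? i j = ((toℕ i ≟ℕ 0) ×-dec (toℕ j ≟ℕ 1)) ⊎-dec ((toℕ i ≟ℕ 1) ×-dec (toℕ j ≟ℕ 0))

exempt⇒toℕ≡1∸toℕ : ∀ {t} {i k : Fin t} → Exempt i k → toℕ i ≡ 1 ∸ toℕ k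
exempt⇒toℕ≡1∸toℕ (inj₁ (i≡0 , k≡1)) rewrite k≡1 = i≡0
exempt⇒toℕ≡1∸toℕ (inj₂ (i≡1 , k≡0)) rewrite k≡0 = i≡1

exempt-unique : ∀ {t} {i j k : Fin t} → Exempt i k → Exempt j k → i ≡ j
exempt-unique exempt-ik exempt-jk =
  toℕ-injective (trans (exempt⇒toℕ≡1∸toℕ exempt-ik) (sym (exempt⇒toℕ≡1∸toℕ exempt-jk)))

partner : ∀ {m} (i : Fin (3 + m)) → ∃ λ j → i ≢ j × ¬ Exempt i j
partner zero             = suc (suc zero) , (λ ()) , λ { (inj₁ (_ , ())) ; (inj₂ (() , _)) }
partner (suc zero)       = suc (suc zero) , (λ ()) , λ { (inj₁ (() , _)) ; (inj₂ (_ , ())) }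
partner (suc (suc i))    = zero , (λ ()) , λ { (inj₁ (() , _)) ; (inj₂ (() , _)) }

third-index : ∀ {m} (i j : Fin (3 + m)) → ∃ λ k → k ≢ i × k ≢ j
third-index zero          zero          = suc zero , (λ ()) , (λ ())
third-index zero          (suc zero)    = suc (suc zero) , (λ ()) , (λ ())
third-index zero          (suc (suc j)) = suc zero , (λ ()) , (λ ())
third-index (suc zero)    zero          = suc (suc zero) , (λ ()) , (λ ())
third-index (suc zero)    (suc zero)    = zero , (λ ()) , (λ ())
third-index (suc zero)    (suc (suc j)) = zero , (λ ()) , (λ ())
third-index (suc (suc i)) zero          = suc zero , (λ ()) , (λ ())
third-index (suc (suc i)) (suc zero)    = zero , (λ ()) , (λ ())
third-index (suc (suc i)) (suc (suc j)) = zero , (λ ()) , (λ ())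

module _ {n : ℕ} (M : Matroid n) (P : Subset n) {t : ℕ} (L : Fin t → Subset n)
         (disjoint : ∀ i j x → x ∈ L i → x ∈ L j → i ≡ j) (L⊆P : ∀ i → L i ⊆ P) where

  ∈-different-blocks⇒≢ : ∀ {a b x y} → x ∈ L a → y ∈ L b → a ≢ b → x ≢ y
  ∈-different-blocks⇒≢ {a} {b} {x} x∈La y∈Lb a≢b refl = a≢b (disjoint a b x x∈La y∈Lb)

  circuit-meets-blocks-again : ∀ {T a b k p q} → Circuit M T → Cocircuit M (L a ∪ L k)
    → p ∈ T → p ∈ L a → q ∈ L b → b ≢ a → b ≢ k
    → ∃ λ u → u ∈ T × u ∈ P × u ≢ p × u ≢ q
  circuit-meets-blocks-again {a = a} {k = k} circuit cocircuit p∈T p∈La q∈Lb b≢a b≢k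
    with circuit-cocircuit-orthogonal M circuit cocircuit p∈T (x∈p∪q⁺ (inj₁ p∈La))
  ... | u , u∈T , u∈La∪Lk , u≢p with x∈p∪q⁻ (L a) (L k) u∈La∪Lk
  ...   | inj₁ u∈La = u , u∈T , L⊆P a u∈La , u≢p , ∈-different-blocks⇒≢ u∈La q∈Lb (≢-sym b≢a)
  ...   | inj₂ u∈Lk = u , u∈T , L⊆P k u∈Lk , u≢p , ∈-different-blocks⇒≢ u∈Lk q∈Lb (≢-sym b≢k)

module _ {n m : ℕ} (M : Matroid n) (P : Subset n) (L : Fin (3 + m) → Subset n)
         (disjoint : ∀ i j x → x ∈ L i → x ∈ L j → i ≡ j) (L⊆P : ∀ i → L i ⊆ P)
         (cocircuit : ∀ i j → i ≢ j → ¬ Exempt i j → Cocircuit M (L i ∪ L j)) where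

  circuit-meets-third-block : ∀ {T i j x z} → Circuit M T → i ≢ j
    → x ∈ T → x ∈ L i → z ∈ T → z ∈ L j → ∃ λ u → u ∈ T × u ∈ P × u ≢ x × u ≢ z
  circuit-meets-third-block {i = i} {j} circuit i≢j x∈T x∈Li z∈T z∈Lj
    with third-index i j
  ... | k , k≢i , k≢j with exempt? i k
  ...   | no ¬exempt-ik = circuit-meets-blocks-again M P L disjoint L⊆P circuit
            (cocircuit i k (≢-sym k≢i) ¬exempt-ik) x∈T x∈Li z∈Lj (≢-sym i≢j) (≢-sym k≢j)
  ...   | yes exempt-ik with circuit-meets-blocks-again M P L disjoint L⊆P circuit
            (cocircuit j k (≢-sym k≢j) (i≢j ∘ exempt-unique exempt-ik)) z∈T z∈Lj x∈Li i≢j (≢-sym k≢i)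
  ...     | u , u∈T , u∈P , u≢z , u≢x = u , u∈T , u∈P , u≢x , u≢z

  triangle-meeting-block-once⇒⊆P : ∀ {T x} i → Triangle M T → x ∈ T → x ∈ L i
    → (∀ {z} → z ∈ T → z ∈ L i → z ≡ x) → T ⊆ P
  triangle-meeting-block-once⇒⊆P {T} {x} i (circuit , ∣T∣≡3) x∈T x∈Li only-x
    with partner i
  ... | j , i≢j , allowed
    with circuit-cocircuit-orthogonal M circuit (cocircuit i j i≢j allowed) x∈T (x∈p∪q⁺ (inj₁ x∈Li))
  ... | z , z∈T , z∈Li∪Lj , z≢x with x∈p∪q⁻ (L i) (L j) z∈Li∪Lj
  ...   | inj₁ z∈Li = contradiction (only-x z∈T z∈Li) z≢x
  ...   | inj₂ z∈Lj with circuit-meets-third-block circuit i≢j x∈T x∈Li z∈T z∈Lj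
  ...     | u , u∈T , u∈P , u≢x , u≢z =
    distinct-filling⇒⊆ ((≢-sym z≢x ∷ ≢-sym u≢x ∷ []) ∷ (≢-sym u≢z ∷ []) ∷ [] ∷ [])
      (x∈T ∷ z∈T ∷ u∈T ∷ []) (L⊆P i x∈Li ∷ L⊆P j z∈Lj ∷ u∈P ∷ []) (≤-reflexive ∣T∣≡3)

lemma5p2 : ∀ {n : ℕ} (M : Matroid n) (P : Subset n) (t : ℕ)
    → ThreeConnected M
    → (∀ T → Triangle M T → ¬ (T ⊆ P))
    → 3 ≤ t
    → (L : Fin t → Subset n)
    → (∀ i → ∣ L i ∣ ≡ 2)
    → (∀ i j x → x ∈ L i → x ∈ L j → i ≡ j)
    → (∀ x → x ∈ P → ∃ λ i → x ∈ L i)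
    → (∀ i → L i ⊆ P)
    → (∀ i j → i ≢ j → ¬ ((toℕ i ≡ 0 × toℕ j ≡ 1) ⊎ (toℕ i ≡ 1 × toℕ j ≡ 0)) → Cocircuit M (L i ∪ L j))
    → ∀ T i → Triangle M T → Nonempty (T ∩ L i) → L i ⊆ T
lemma5p2 M P _ _ noTriangle (s≤s (s≤s (s≤s _))) L ∣L∣≡2 disjoint _ L⊆P cocircuit T i triangle (x , x∈T∩Li) {y} y∈Li
  with y ∈? T
... | yes y∈T = y∈T
... | no y∉T = ⊥-elim (noTriangle T triangle
  (triangle-meeting-block-once⇒⊆P M P L disjoint L⊆P cocircuit i triangle x∈T x∈Li only-x))
  where
  x∈T : x ∈ T
  x∈T = proj₁ (x∈p∩q⁻ T (L i) x∈T∩Li)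
  x∈Li : x ∈ L i
  x∈Li = proj₂ (x∈p∩q⁻ T (L i) x∈T∩Li)
  only-x : ∀ {z} → z ∈ T → z ∈ L i → z ≡ x
  only-x {z} z∈T z∈Li with z ≟ x
  ... | yes z≡x = z≡x
  ... | no z≢x = contradiction (subst (3 ≤_) (∣L∣≡2 i) (distinct⇒length≤∣p∣
          ((x≢y ∷ ≢-sym z≢x ∷ []) ∷ (y≢z ∷ []) ∷ [] ∷ []) (x∈Li ∷ y∈Li ∷ z∈Li ∷ []))) λ { (s≤s (s≤s ())) }
    where
    x≢y : x ≢ y
    x≢y x≡y = y∉T (subst (_∈ T) x≡y x∈T)
    y≢z : y ≢ z
    y≢z y≡z = y∉T (subst (_∈ T) (sym y≡z) z∈T)
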